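{- Let $C$ be a cycle of length $s\ge 3$ in a graph $G$, and let $u_1,u_2\in V(G)\setminus V(C)$ be two distinct vertices with $\deg_C(u_1)>0$ and $\deg_C(u_2)>0$. Suppose neither $N_C(u_1)$ nor $N_C(u_2)$ contains two consecutive vertices of $C$. Then: (1) If $N_C(u_1)\cap N_C(u_2)=\emptyset$, there exist $v_1\in N_C(u_1)$ and $v_2\in N_C(u_2)$ with $1\le \mathrm{dist}_C(v_1,v_2)\le \max\{1,\lfloor s/2\rfloor+2-\deg_C(u_1)-\deg_C(u_2)\}$. (2) If $\deg_C(u_1)\ge 2$, there exist $v_1\in N_C(u_1)$ and $v_2\in N_C(u_2)$ with $1\le \mathrm{dist}_C(v_1,v_2)\le \max\{3,\ s/\deg_C(u_1),\ \lfloor s/2\rfloor+3-\deg_C(u_1)-\deg_C(u_2)\}$.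
   Context: $N_C(u)$ is the set of neighbours of $u$ on $C$, $\deg_C(u)=|N_C(u)|$, and $\mathrm{dist}_C(v_1,v_2)$ is the distance between $v_1,v_2$ along the cycle $C$. -}

module Defs where

open import Data.Bool using (Bool; true; false)
open import Data.Nat as ℕ using (ℕ; zero; suc; _⊓_; _∸_; ∣_-_∣)
open import Data.Fin using (Fin; toℕ)
open import Data.Fin.Subset using (Subset; _∈_; _∩_; ⊥)
open import Data.Vec using (tabulate)
open import Data.Integer using (ℤ; +_)
open import Data.Rational as Q using (ℚ; 0ℚ)
open import Relation.Binary.PropositionalEquality using (_≡_; _≢_)
open import Relation.Nullary using (¬_)
open import Data.Product using (_×_)
open import Function.Definitions using (Injective)

record Graph (n : ℕ) : Set where
  field
    Adj   : Fin n → Fin n → Bool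
    sym   : ∀ x y → Adj x y ≡ Adj y x
    irref : ∀ x → Adj x x ≡ false

open Graph public

cdist : {s : ℕ} → Fin s → Fin s → ℕ
cdist {s} i j = ∣ toℕ i - toℕ j ∣ ⊓ (s ∸ ∣ toℕ i - toℕ j ∣)

record Cycle {n : ℕ} (G : Graph n) (s : ℕ) : Set where
  field
    vert   : Fin s → Fin n
    inj    : Injective _≡_ _≡_ vert
    edges  : ∀ i j → cdist i j ≡ 1 → Adj G (vert i) (vert j) ≡ true

open Cycle public

OnCycle : {n s : ℕ} {G : Graph n} → Cycle G s → Fin n → Set
OnCycle {s = s} C u = Data.Product.Σ (Fin s) (λ i → vert C i ≡ u)
  where import Data.Product

NC : {n s : ℕ} {G : Graph n} → Cycle G s → Fin n → Subset s
NC {G = G} C u = tabulate (λ i → Adj G u (vert C i))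

degC : {n s : ℕ} {G : Graph n} → Cycle G s → Fin n → ℕ
degC C u = Data.Fin.Subset.∣ NC C u ∣

NoConsecutive : {n s : ℕ} {G : Graph n} → Cycle G s → Fin n → Set
NoConsecutive {s = s} C u =
  ∀ (i j : Fin s) → cdist i j ≡ 1 → ¬ (i ∈ NC C u × j ∈ NC C u)

ℕ→ℚ : ℕ → ℚ
ℕ→ℚ m = (+ m) Q./ 1

-- s / d as a rational number (d = 0 gives 0; only used with d ≥ 2)
_/ℕ_ : ℕ → ℕ → ℚ
s /ℕ zero = 0ℚ
s /ℕ suc k = (+ s) Q./ suc k

{-# OPTIONS --safe #-}
module Submission where

-- Only the neighbourhoods matter: A = N_C(u₁) and B = N_C(u₂) are independent sets of positions
-- on the cycle. Let d be the least
-- distance between distinct points v₁ ∈ A, v₂ ∈ B. Walk once around the cycle through the k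
-- points of A ∪ B: consecutive points are at distance at least 2, and at least d when the step
-- is mixed (one end can serve as a point of A, the other as a point of B). The gaps add up to s,
-- so 2k + (d - 2) m ≤ s for the number m of mixed steps. Every step that starts in A ∩ B or
-- leaves a run of points of A ∖ B or of B ∖ A is mixed; hence m ≥ 2 and m ≥ |A ∩ B| + 1, unless
-- all points lie in A ∩ B, in which case m = k = |A|. Together with |A| + |B| = k + |A ∩ B|
-- this gives d + |A| + |B| ≤ s/2 + 2 when A ∩ B = ∅, and, for d ≥ 4, d |A| ≤ s or
-- d + |A| + |B| ≤ s/2 + 3.

open import Defs hiding (sym)
open import Algebra.Bundles using (AbelianGroup)
import Algebra.Properties.Group as GroupProperties
open import Data.Bool using (Bool; true; false; _∧_; _∨_; not; if_then_else_)
open import Data.Fin as Fin using (Fin; zero; suc; toℕ)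
import Data.Fin.Properties as FinP
open import Data.Fin.Subset using (Subset; _∈_; _∩_; ⊥; ∣_∣)
open import Data.Fin.Subset.Properties using (_∈?_; ∣⊥∣≡0)
open import Data.Integer as Z using (+_; _-_)
import Data.Integer.Properties as ZP
open import Data.List using (List; []; _∷_; _++_; [_]; length; map)
open import Data.List.Properties using (length-++; length-map; map-++; map-∘)
open import Data.List.Relation.Unary.All using (All; []; _∷_)
import Data.List.Relation.Unary.All.Properties as All
open import Data.List.Relation.Unary.Any as Any using (Any; here; there)
open import Data.List.Relation.Unary.Any.Properties using (++⁺ˡ; ++⁺ʳ)
open import Data.List.Relation.Unary.Linked as Linked using (Linked; []; [-]; _∷_)
import Data.List.Relation.Unary.Linked.Properties as Linked
open import Data.Nat as ℕ
  using (ℕ; zero; suc; _+_; _*_; _∸_; _/_; _≤_; _<_; z≤n; s≤s; z<s; s<s)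
open import Data.Nat.Coprimality as Coprimality using (1-coprimeTo)
open import Data.Nat.DivMod using (m*n/n≡m; /-monoˡ-≤)
open import Data.Nat.ListAction using (sum)
open import Data.Nat.Properties
open import Algebra.Properties.CommutativeSemigroup +-commutativeSemigroup
  using (interchange; x∙yz≈y∙xz; xy∙z≈y∙xz; xy∙z≈xz∙y)
open import Data.Nat.Tactic.RingSolver using (solve-∀)
import Data.Rational as Q
import Data.Rational.Properties as QP
open import Data.Rational.Unnormalised as U using (mkℚᵘ; *≤*)
import Data.Rational.Unnormalised.Properties as UP
open import Data.Product using (_×_; ∃-syntax; _,_; proj₁; proj₂)
open import Data.Sum using (_⊎_; inj₁; inj₂)
open import Data.Vec using ([]; _∷_; lookup)
open import Data.Vec.Properties using (lookup⇒[]=)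
open import Function using (_∘_; _on_)
open import Relation.Binary.PropositionalEquality
  using (_≡_; _≢_; refl; sym; trans; cong; cong₂; subst; subst₂; module ≡-Reasoning)
open import Relation.Nullary using (¬_; Dec; yes; no; does; ¬?; contradiction)
open import Relation.Nullary.Decidable using (dec-true; dec-false; _×-dec_)
open import Relation.Unary using (Decidable)

-- Sums along the steps of a cyclic sequence

pathSum : {X : Set} → (X → X → ℕ) → X → List X → ℕ
pathSum f x []       = 0
pathSum f x (y ∷ ys) = f x y + pathSum f y ys

cyclicSum : {X : Set} → (X → X → ℕ) → List X → ℕ
cyclicSum f []       = 0
cyclicSum f (x ∷ xs) = pathSum f x (xs ++ [ x ])

module _ {X : Set} where

  pathSum-+ : {f g h : X → X → ℕ} → (∀ x y → f x y ≡ g x y + h x y) →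
              ∀ x ys → pathSum f x ys ≡ pathSum g x ys + pathSum h x ys
  pathSum-+ f≡g+h x []                     = refl
  pathSum-+ {g = g} {h} f≡g+h x (y ∷ ys) rewrite f≡g+h x y | pathSum-+ f≡g+h y ys =
    interchange (g x y) (h x y) (pathSum g y ys) (pathSum h y ys)

  cyclicSum-+ : {f g h : X → X → ℕ} → (∀ x y → f x y ≡ g x y + h x y) →
                ∀ xs → cyclicSum f xs ≡ cyclicSum g xs + cyclicSum h xs
  cyclicSum-+ f≡g+h []       = refl
  cyclicSum-+ f≡g+h (x ∷ xs) = pathSum-+ f≡g+h x (xs ++ [ x ])

  pathSum-affine : ∀ c m (f : X → X → ℕ) x ys →
    pathSum (λ a b → c + m * f a b) x ys ≡ c * length ys + m * pathSum f x ys
  pathSum-affine c m f x []       = sym (cong₂ _+_ (*-zeroʳ c) (*-zeroʳ m))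
  pathSum-affine c m f x (y ∷ ys) rewrite pathSum-affine c m f y ys =
    regroup c m (f x y) (length ys) (pathSum f y ys)
    where
    regroup : ∀ c m u n p → c + m * u + (c * n + m * p) ≡ c * suc n + m * (u + p)
    regroup = solve-∀

  cyclicSum-affine : ∀ c m (f : X → X → ℕ) xs →
    cyclicSum (λ a b → c + m * f a b) xs ≡ c * length xs + m * cyclicSum f xs
  cyclicSum-affine c m f []       = sym (cong₂ _+_ (*-zeroʳ c) (*-zeroʳ m))
  cyclicSum-affine c m f (x ∷ xs) rewrite pathSum-affine c m f x (xs ++ [ x ])
    | length-++ xs {[ x ]} | +-comm (length xs) 1 = refl

  cyclicSum-first : ∀ (f : X → ℕ) xs → cyclicSum (λ a _ → f a) xs ≡ sum (map f xs)
  cyclicSum-first f []       = refl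
  cyclicSum-first f (x ∷ xs) = pathSum-first x xs
    where
    pathSum-first : ∀ x ys {z} → pathSum (λ a _ → f a) x (ys ++ [ z ]) ≡ sum (map f (x ∷ ys))
    pathSum-first x []       = refl
    pathSum-first x (y ∷ ys) = cong (_+_ (f x)) (pathSum-first y ys)

  pathSum-map : {Y : Set} (f : X → X → ℕ) (h : Y → X) (y : Y) (ys : List Y) →
    pathSum f (h y) (map h ys) ≡ pathSum (λ a b → f (h a) (h b)) y ys
  pathSum-map f h y []        = refl
  pathSum-map f h y (y′ ∷ ys) = cong (_+_ (f (h y) (h y′))) (pathSum-map f h y′ ys)

  cyclicSum-map : {Y : Set} (f : X → X → ℕ) (h : Y → X) (ys : List Y) →
    cyclicSum f (map h ys) ≡ cyclicSum (λ a b → f (h a) (h b)) ys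
  cyclicSum-map f h []       = refl
  cyclicSum-map f h (y ∷ ys) rewrite sym (map-++ h ys [ y ]) = pathSum-map f h y (ys ++ [ y ])

module _ {X : Set} {P : X → Set} (P? : Decidable P) where

  leaving : X → X → ℕ
  leaving x y = if does (P? x) ∧ not (does (P? y)) then 1 else 0

  leaving≡1 : ∀ {x y} → P x → ¬ P y → leaving x y ≡ 1
  leaving≡1 {x} {y} px ¬py rewrite dec-true (P? x) px | dec-false (P? y) ¬py = refl

  pathSum-leaving-from>0 : ∀ {x} ys → P x → Any (¬_ ∘ P) ys → 0 < pathSum leaving x ys
  pathSum-leaving-from>0 {x} (y ∷ ys) px ¬p∈ = step (P? y) ¬p∈
    where
    step : Dec (P y) → Any (¬_ ∘ P) (y ∷ ys) → 0 < leaving x y + pathSum leaving y ys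
    step (no ¬py) _             = ≤-trans (≤-reflexive (sym (leaving≡1 px ¬py))) (m≤m+n _ _)
    step (yes py) (here ¬py)    = contradiction py ¬py
    step (yes py) (there ¬p∈ys) = ≤-trans (pathSum-leaving-from>0 ys py ¬p∈ys) (m≤n+m _ _)

  pathSum-leaving>0 : ∀ x pre post → Any P (x ∷ pre) → Any (¬_ ∘ P) post →
                      0 < pathSum leaving x (pre ++ post)
  pathSum-leaving>0 x pre       post (here px)  ¬p∈ = pathSum-leaving-from>0 (pre ++ post) px (++⁺ʳ pre ¬p∈)
  pathSum-leaving>0 x (y ∷ pre) post (there p∈) ¬p∈ =
    ≤-trans (pathSum-leaving>0 y pre post p∈ ¬p∈) (m≤n+m _ _)

  cyclicSum-leaving>0 : ∀ xs → Any P xs → Any (¬_ ∘ P) xs → 0 < cyclicSum leaving xs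
  cyclicSum-leaving>0 (x ∷ xs) p∈ ¬p∈ with P? x | ¬p∈
  ... | yes px | here ¬px     = contradiction px ¬px
  ... | yes px | there ¬p∈xs = pathSum-leaving>0 x [] (xs ++ [ x ]) (here px) (++⁺ˡ ¬p∈xs)
  ... | no ¬px | _            = pathSum-leaving>0 x xs [ x ] p∈ (here ¬px)

-- Gaps between points of the cycle

Increasing : {s : ℕ} → List (Fin s) → Set
Increasing = Linked (_<_ on toℕ)

∣i-j∣<s : {s : ℕ} (i j : Fin s) → ℕ.∣ toℕ i - toℕ j ∣ < s
∣i-j∣<s i j = ≤-<-trans (∣m-n∣≤m⊔n (toℕ i) (toℕ j)) (⊔-lub (FinP.toℕ<n i) (FinP.toℕ<n j))

cdist-comm : {s : ℕ} (i j : Fin s) → cdist i j ≡ cdist j i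
cdist-comm i j rewrite ∣-∣-comm (toℕ i) (toℕ j) = refl

cdist>0 : {s : ℕ} {i j : Fin s} → i ≢ j → 0 < cdist i j
cdist>0 {i = i} {j} i≢j =
  ⊓-glb (n≢0⇒n>0 (i≢j ∘ FinP.toℕ-injective ∘ ∣m-n∣≡0⇒m≡n)) (m<n⇒0<n∸m (∣i-j∣<s i j))

s∸[j∸i]+j≡s+i : ∀ {s i j} → i ≤ j → j ≤ s → s ∸ (j ∸ i) + j ≡ s + i
s∸[j∸i]+j≡s+i {s} {i} {j} i≤j j≤s = begin
  s ∸ (j ∸ i) + j           ≡⟨ cong (_+_ (s ∸ (j ∸ i))) (sym (m∸n+n≡m i≤j)) ⟩
  s ∸ (j ∸ i) + (j ∸ i + i) ≡⟨ sym (+-assoc (s ∸ (j ∸ i)) (j ∸ i) i) ⟩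
  s ∸ (j ∸ i) + (j ∸ i) + i ≡⟨ cong (_+ i) (m∸n+n≡m (≤-trans (m∸n≤m j i) j≤s)) ⟩
  s + i                     ∎
  where open ≡-Reasoning

+-≤-compose : ∀ a b c {d t} → a + c ≤ d → b + d ≤ t → a + b + c ≤ t
+-≤-compose a b c {d} {t} a+c≤d b+d≤t = begin
  a + b + c   ≡⟨ xy∙z≈y∙xz a b c ⟩
  b + (a + c) ≤⟨ +-monoʳ-≤ b a+c≤d ⟩
  b + d       ≤⟨ b+d≤t ⟩
  t           ∎
  where open ≤-Reasoning

module _ {s : ℕ} {P : Fin s → Set} (w : Fin s → Fin s → ℕ)
         (w≤cdist : ∀ {i j} → P i → P j → i ≢ j → w i j ≤ cdist i j) where

  forward-gap : ∀ {i j} → P i → P j → toℕ i < toℕ j → w i j + toℕ i ≤ toℕ j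
  forward-gap {i} {j} pi pj i<j = begin
    w i j + toℕ i               ≤⟨ +-monoˡ-≤ (toℕ i) (≤-trans (w≤cdist pi pj i≢j) (m⊓n≤m _ _)) ⟩
    ℕ.∣ toℕ i - toℕ j ∣ + toℕ i ≡⟨ cong (_+ toℕ i) (m≤n⇒∣m-n∣≡n∸m (<⇒≤ i<j)) ⟩
    toℕ j ∸ toℕ i + toℕ i       ≡⟨ m∸n+n≡m (<⇒≤ i<j) ⟩
    toℕ j                       ∎
    where
    open ≤-Reasoning
    i≢j : i ≢ j
    i≢j = <⇒≢ i<j ∘ cong toℕ

  wrap-gap : ∀ {i j} → P i → P j → toℕ i < toℕ j → w j i + toℕ j ≤ s + toℕ i
  wrap-gap {i} {j} pi pj i<j = begin
    w j i + toℕ j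
      ≤⟨ +-monoˡ-≤ (toℕ j) (≤-trans (w≤cdist pj pi j≢i) (m⊓n≤n _ _)) ⟩
    s ∸ ℕ.∣ toℕ j - toℕ i ∣ + toℕ j
      ≡⟨ cong (λ d → s ∸ d + toℕ j) (m≤n⇒∣n-m∣≡n∸m (<⇒≤ i<j)) ⟩
    s ∸ (toℕ j ∸ toℕ i) + toℕ j
      ≡⟨ s∸[j∸i]+j≡s+i (<⇒≤ i<j) (<⇒≤ (FinP.toℕ<n j)) ⟩
    s + toℕ i
      ∎
    where
    open ≤-Reasoning
    j≢i : j ≢ i
    j≢i = <⇒≢ i<j ∘ cong toℕ ∘ sym

  pathSum-wrap : ∀ h x ys → toℕ h < toℕ x → Increasing (x ∷ ys) → All P (h ∷ x ∷ ys) →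
                 pathSum w x (ys ++ [ h ]) + toℕ x ≤ s + toℕ h
  pathSum-wrap h x []       h<x _            (ph ∷ px ∷ []) =
    +-≤-compose (w x h) 0 (toℕ x) (wrap-gap ph px h<x) ≤-refl
  pathSum-wrap h x (y ∷ ys) h<x (x<y ∷ incr) (ph ∷ px ∷ pys@(py ∷ _)) =
    +-≤-compose (w x y) _ (toℕ x) (forward-gap px py x<y)
      (pathSum-wrap h y ys (<-trans h<x x<y) incr (ph ∷ pys))

  -- The forward gaps between cyclically consecutive points of an increasing list add up to s.
  cyclicSum≤cycleLength : ∀ xs → 2 ≤ length xs → Increasing xs → All P xs → cyclicSum w xs ≤ s
  cyclicSum≤cycleLength (_ ∷ [])     (s≤s ()) _ _
  cyclicSum≤cycleLength (x ∷ y ∷ ys) _ (x<y ∷ incr) (px ∷ pys@(py ∷ _)) = +-cancelʳ-≤ (toℕ x) _ _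
    (+-≤-compose (w x y) _ (toℕ x) (forward-gap px py x<y) (pathSum-wrap x y ys x<y incr (px ∷ pys)))

-- Points of A ∪ B labelled by membership

data Label : Set where
  onlyA onlyB both : Label

_≟ᴸ_ : (x y : Label) → Dec (x ≡ y)
onlyA ≟ᴸ onlyA = yes refl
onlyA ≟ᴸ onlyB = no λ ()
onlyA ≟ᴸ both  = no λ ()
onlyB ≟ᴸ onlyA = no λ ()
onlyB ≟ᴸ onlyB = yes refl
onlyB ≟ᴸ both  = no λ ()
both  ≟ᴸ onlyA = no λ ()
both  ≟ᴸ onlyB = no λ ()
both  ≟ᴸ both  = yes refl

isA isB isBoth : Label → ℕ
isA onlyB = 0
isA _     = 1
isB onlyA = 0
isB _     = 1
isBoth both = 1
isBoth _    = 0

countA countB countBoth : List Label → ℕ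
countA    xs = sum (map isA xs)
countB    xs = sum (map isB xs)
countBoth xs = sum (map isBoth xs)

countA+countB : ∀ xs → countA xs + countB xs ≡ length xs + countBoth xs
countA+countB []       = refl
countA+countB (x ∷ xs) = begin
  isA x + countA xs + (isB x + countB xs)
    ≡⟨ interchange (isA x) (countA xs) (isB x) (countB xs) ⟩
  isA x + isB x + (countA xs + countB xs)
    ≡⟨ cong₂ _+_ (isA+isB x) (countA+countB xs) ⟩
  suc (isBoth x) + (length xs + countBoth xs)
    ≡⟨ cong suc (x∙yz≈y∙xz (isBoth x) (length xs) (countBoth xs)) ⟩
  suc (length xs + (isBoth x + countBoth xs))
    ∎
  where
  open ≡-Reasoning
  isA+isB : ∀ x → isA x + isB x ≡ suc (isBoth x)
  isA+isB onlyA = refl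
  isA+isB onlyB = refl
  isA+isB both  = refl

countA≤length : ∀ xs → countA xs ≤ length xs
countA≤length []           = z≤n
countA≤length (onlyA ∷ xs) = s≤s (countA≤length xs)
countA≤length (onlyB ∷ xs) = m≤n⇒m≤1+n (countA≤length xs)
countA≤length (both  ∷ xs) = s≤s (countA≤length xs)

mixed : Label → Label → ℕ
mixed onlyA onlyA = 0
mixed onlyB onlyB = 0
mixed _     _     = 1

mixed≡0⊎mixed≡1 : ∀ x y → mixed x y ≡ 0 ⊎ mixed x y ≡ 1
mixed≡0⊎mixed≡1 onlyA onlyA = inj₁ refl
mixed≡0⊎mixed≡1 onlyA onlyB = inj₂ refl
mixed≡0⊎mixed≡1 onlyA both  = inj₂ refl
mixed≡0⊎mixed≡1 onlyB onlyA = inj₂ refl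
mixed≡0⊎mixed≡1 onlyB onlyB = inj₁ refl
mixed≡0⊎mixed≡1 onlyB both  = inj₂ refl
mixed≡0⊎mixed≡1 both  _     = inj₂ refl

leavingA leavingB : Label → Label → ℕ
leavingA = leaving (_≟ᴸ onlyA)
leavingB = leaving (_≟ᴸ onlyB)

mixed-split : ∀ x y → mixed x y ≡ isBoth x + leavingA x y + leavingB x y
mixed-split onlyA onlyA = refl
mixed-split onlyA onlyB = refl
mixed-split onlyA both  = refl
mixed-split onlyB onlyA = refl
mixed-split onlyB onlyB = refl
mixed-split onlyB both  = refl
mixed-split both  onlyA = refl
mixed-split both  onlyB = refl
mixed-split both  both  = refl

leavings : List Label → ℕ
leavings xs = cyclicSum leavingA xs + cyclicSum leavingB xs

cyclicSum-mixed : ∀ xs → cyclicSum mixed xs ≡ countBoth xs + leavings xs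
cyclicSum-mixed xs = begin
  cyclicSum mixed xs
    ≡⟨ cyclicSum-+ {g = λ x y → isBoth x + leavingA x y} {h = leavingB} mixed-split xs ⟩
  cyclicSum (λ x y → isBoth x + leavingA x y) xs + cyclicSum leavingB xs
    ≡⟨ cong (_+ cyclicSum leavingB xs)
            (cyclicSum-+ {g = λ x _ → isBoth x} {h = leavingA} (λ _ _ → refl) xs) ⟩
  cyclicSum (λ x _ → isBoth x) xs + cyclicSum leavingA xs + cyclicSum leavingB xs
    ≡⟨ cong (λ n → n + cyclicSum leavingA xs + cyclicSum leavingB xs) (cyclicSum-first isBoth xs) ⟩
  countBoth xs + cyclicSum leavingA xs + cyclicSum leavingB xs
    ≡⟨ +-assoc (countBoth xs) _ _ ⟩
  countBoth xs + leavings xs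
    ∎
  where open ≡-Reasoning

countBoth≤mixed : ∀ xs → countBoth xs ≤ cyclicSum mixed xs
countBoth≤mixed xs rewrite cyclicSum-mixed xs = m≤m+n _ _

both-present : ∀ xs → 0 < countBoth xs → Any (_≡ both) xs
both-present (onlyA ∷ xs) c>0 = there (both-present xs c>0)
both-present (onlyB ∷ xs) c>0 = there (both-present xs c>0)
both-present (both  ∷ xs) _   = here refl

onlyA-present : ∀ xs → countBoth xs ≡ 0 → 0 < countA xs → Any (_≡ onlyA) xs
onlyA-present (onlyA ∷ xs) _   _   = here refl
onlyA-present (onlyB ∷ xs) c≡0 a>0 = there (onlyA-present xs c≡0 a>0)

onlyB-present : ∀ xs → countBoth xs ≡ 0 → 0 < countB xs → Any (_≡ onlyB) xs
onlyB-present (onlyA ∷ xs) c≡0 b>0 = there (onlyB-present xs c≡0 b>0)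
onlyB-present (onlyB ∷ xs) _   _   = here refl

onlyA-or-onlyB-present : ∀ xs → countBoth xs < length xs → Any (_≡ onlyA) xs ⊎ Any (_≡ onlyB) xs
onlyA-or-onlyB-present (onlyA ∷ xs) _         = inj₁ (here refl)
onlyA-or-onlyB-present (onlyB ∷ xs) _         = inj₂ (here refl)
onlyA-or-onlyB-present (both  ∷ xs) (s≤s c<k) with onlyA-or-onlyB-present xs c<k
... | inj₁ a∈ = inj₁ (there a∈)
... | inj₂ b∈ = inj₂ (there b∈)

leavings>0 : ∀ xs → 0 < countBoth xs → countBoth xs < length xs → 0 < leavings xs
leavings>0 xs c>0 c<k with onlyA-or-onlyB-present xs c<k | both-present xs c>0
... | inj₁ a∈ | both∈ = ≤-trans (cyclicSum-leaving>0 (_≟ᴸ onlyA) xs a∈ (Any.map (λ { refl () }) both∈)) (m≤m+n _ _)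
... | inj₂ b∈ | both∈ = ≤-trans (cyclicSum-leaving>0 (_≟ᴸ onlyB) xs b∈ (Any.map (λ { refl () }) both∈)) (m≤n+m _ _)

leavings≥2 : ∀ xs → countBoth xs ≡ 0 → 0 < countA xs → 0 < countB xs → 2 ≤ leavings xs
leavings≥2 xs c≡0 a>0 b>0 = +-mono-≤
  (cyclicSum-leaving>0 (_≟ᴸ onlyA) xs a∈ (Any.map (λ { refl () }) b∈))
  (cyclicSum-leaving>0 (_≟ᴸ onlyB) xs b∈ (Any.map (λ { refl () }) a∈))
  where
  a∈ = onlyA-present xs c≡0 a>0
  b∈ = onlyB-present xs c≡0 b>0

mixed-lower-bounds : ∀ xs → 0 < countA xs → 0 < countB xs → countBoth xs < length xs →
                     2 ≤ cyclicSum mixed xs × suc (countBoth xs) ≤ cyclicSum mixed xs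
mixed-lower-bounds xs a>0 b>0 c<k rewrite cyclicSum-mixed xs =
  bounds (countBoth xs) (λ c≡0 → leavings≥2 xs c≡0 a>0 b>0) (λ c>0 → leavings>0 xs c>0 c<k)
  where
  bounds : ∀ c {e} → (c ≡ 0 → 2 ≤ e) → (0 < c → 0 < e) → 2 ≤ c + e × suc c ≤ c + e
  bounds zero    e≥2 _   = e≥2 refl , ≤-trans (s≤s z≤n) (e≥2 refl)
  bounds (suc c) {e} _ e>0 = ≤-trans (s≤s (s≤s z≤n)) c+2≤ , c+2≤
    where
    c+2≤ : suc (suc c) ≤ suc c + e
    c+2≤ = s≤s (subst (_≤ c + e) (+-comm c 1) (+-monoʳ-≤ c (e>0 z<s)))

-- Points outside A ∪ B never occur in the support; their label onlyB is arbitrary.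
label : Bool → Bool → Label
label true  true  = both
label true  false = onlyA
label false _     = onlyB

labelAt : {s : ℕ} → Subset s → Subset s → Fin s → Label
labelAt A B i = label (lookup A i) (lookup B i)

InUnion : {s : ℕ} → Subset s → Subset s → Fin s → Set
InUnion A B i = lookup A i ∨ lookup B i ≡ true

support : {s : ℕ} → Subset s → Subset s → List (Fin s)
support []          []          = []
support (true  ∷ A) (_     ∷ B) = zero ∷ map suc (support A B)
support (false ∷ A) (true  ∷ B) = zero ∷ map suc (support A B)
support (false ∷ A) (false ∷ B) = map suc (support A B)

labels : {s : ℕ} → Subset s → Subset s → List Label
labels A B = map (labelAt A B) (support A B)

increasing-suc : {s : ℕ} {xs : List (Fin s)} → Increasing xs → Increasing (map suc xs)
increasing-suc = Linked.map⁺ ∘ Linked.map s<s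

increasing-zero∷suc : {s : ℕ} {xs : List (Fin s)} → Increasing xs → Increasing (zero ∷ map suc xs)
increasing-zero∷suc {xs = []}    _    = [-]
increasing-zero∷suc {xs = _ ∷ _} incr = z<s ∷ increasing-suc incr

support-increasing : {s : ℕ} (A B : Subset s) → Increasing (support A B)
support-increasing []          []          = []
support-increasing (true  ∷ A) (_     ∷ B) = increasing-zero∷suc (support-increasing A B)
support-increasing (false ∷ A) (true  ∷ B) = increasing-zero∷suc (support-increasing A B)
support-increasing (false ∷ A) (false ∷ B) = increasing-suc (support-increasing A B)

support⊆union : {s : ℕ} (A B : Subset s) → All (InUnion A B) (support A B)
support⊆union []          []          = []
support⊆union (true  ∷ A) (_     ∷ B) = refl ∷ All.map⁺ (support⊆union A B)
support⊆union (false ∷ A) (true  ∷ B) = refl ∷ All.map⁺ (support⊆union A B)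
support⊆union (false ∷ A) (false ∷ B) = All.map⁺ (support⊆union A B)

labels-tail : {s : ℕ} (x y : Bool) (A B : Subset s) →
              map (labelAt (x ∷ A) (y ∷ B)) (map suc (support A B)) ≡ labels A B
labels-tail x y A B = sym (map-∘ (support A B))

countA-labels : {s : ℕ} (A B : Subset s) → countA (labels A B) ≡ ∣ A ∣
countA-labels []          []          = refl
countA-labels (true  ∷ A) (true  ∷ B) rewrite labels-tail true  true  A B = cong suc (countA-labels A B)
countA-labels (true  ∷ A) (false ∷ B) rewrite labels-tail true  false A B = cong suc (countA-labels A B)
countA-labels (false ∷ A) (true  ∷ B) rewrite labels-tail false true  A B = countA-labels A B
countA-labels (false ∷ A) (false ∷ B) rewrite labels-tail false false A B = countA-labels A B

countB-labels : {s : ℕ} (A B : Subset s) → countB (labels A B) ≡ ∣ B ∣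
countB-labels []          []          = refl
countB-labels (true  ∷ A) (true  ∷ B) rewrite labels-tail true  true  A B = cong suc (countB-labels A B)
countB-labels (true  ∷ A) (false ∷ B) rewrite labels-tail true  false A B = countB-labels A B
countB-labels (false ∷ A) (true  ∷ B) rewrite labels-tail false true  A B = cong suc (countB-labels A B)
countB-labels (false ∷ A) (false ∷ B) rewrite labels-tail false false A B = countB-labels A B

countBoth-labels : {s : ℕ} (A B : Subset s) → countBoth (labels A B) ≡ ∣ A ∩ B ∣
countBoth-labels []          []          = refl
countBoth-labels (true  ∷ A) (true  ∷ B) rewrite labels-tail true  true  A B = cong suc (countBoth-labels A B)
countBoth-labels (true  ∷ A) (false ∷ B) rewrite labels-tail true  false A B = countBoth-labels A B
countBoth-labels (false ∷ A) (true  ∷ B) rewrite labels-tail false true  A B = countBoth-labels A B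
countBoth-labels (false ∷ A) (false ∷ B) rewrite labels-tail false false A B = countBoth-labels A B

∣A∣+∣B∣≡length+countBoth : {s : ℕ} (A B : Subset s) →
  ∣ A ∣ + ∣ B ∣ ≡ length (labels A B) + countBoth (labels A B)
∣A∣+∣B∣≡length+countBoth A B = begin
  ∣ A ∣ + ∣ B ∣
    ≡⟨ sym (cong₂ _+_ (countA-labels A B) (countB-labels A B)) ⟩
  countA (labels A B) + countB (labels A B)
    ≡⟨ countA+countB (labels A B) ⟩
  length (labels A B) + countBoth (labels A B)
    ∎
  where open ≡-Reasoning

-- Independent sets whose distinct cross pairs are far apart

Independent : {s : ℕ} → Subset s → Set
Independent {s} A = ∀ (i j : Fin s) → cdist i j ≡ 1 → ¬ (i ∈ A × j ∈ A)

FarApart : {s : ℕ} → Subset s → Subset s → ℕ → Set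
FarApart {s} A B g = ∀ (i j : Fin s) → i ∈ A → j ∈ B → i ≢ j → g ≤ cdist i j

ClosestPair : {s : ℕ} → Subset s → Subset s → Set
ClosestPair A B = ∃[ v₁ ] ∃[ v₂ ] (v₁ ∈ A × v₂ ∈ B × v₁ ≢ v₂ × FarApart A B (cdist v₁ v₂))

farApart⊎closestPair : {s : ℕ} (A B : Subset s) (g : ℕ) → FarApart A B g ⊎ ClosestPair A B
farApart⊎closestPair A B zero = inj₁ (λ _ _ _ _ _ → z≤n)
farApart⊎closestPair A B (suc g) with farApart⊎closestPair A B g
... | inj₂ closest = inj₂ closest
... | inj₁ far with FinP.any? (λ i → FinP.any? (λ j →
                      (i ∈? A) ×-dec (j ∈? B) ×-dec ¬? (i Fin.≟ j) ×-dec (cdist i j ≟ g)))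
...   | yes (v₁ , v₂ , v₁∈A , v₂∈B , v₁≢v₂ , d≡g) =
          inj₂ (v₁ , v₂ , v₁∈A , v₂∈B , v₁≢v₂ , subst (FarApart A B) (sym d≡g) far)
...   | no none = inj₁ λ i j i∈A j∈B i≢j →
          ≤∧≢⇒< (far i j i∈A j∈B i≢j) (λ g≡d → none (i , j , i∈A , j∈B , i≢j , sym g≡d))

weight : ℕ → Label → Label → ℕ
weight h x y = 2 + h * mixed x y

∨≡true : ∀ x y → x ∨ y ≡ true → x ≡ true ⊎ y ≡ true
∨≡true true  _ _      = inj₁ refl
∨≡true false _ y≡true = inj₂ y≡true

mixed-label : ∀ x y x′ y′ → x ∨ y ≡ true → x′ ∨ y′ ≡ true →
              mixed (label x y) (label x′ y′) ≡ 1 → (x ≡ true × y′ ≡ true) ⊎ (y ≡ true × x′ ≡ true)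
mixed-label true  true  _     true  _ _ _ = inj₁ (refl , refl)
mixed-label true  true  true  false _ _ _ = inj₂ (refl , refl)
mixed-label true  false _     true  _ _ _ = inj₁ (refl , refl)
mixed-label true  false true  false _ _ ()
mixed-label false true  true  _     _ _ _ = inj₂ (refl , refl)
mixed-label false true  false true  _ _ ()
mixed-label _     _     false false _ () _
mixed-label false false _     _     () _ _

module _ {s : ℕ} {A B : Subset s} {h : ℕ}
         (indA : Independent A) (indB : Independent B) (far : FarApart A B (2 + h)) where

  ∈-union : ∀ {i} → InUnion A B i → i ∈ A ⊎ i ∈ B
  ∈-union {i} i∈ with ∨≡true (lookup A i) (lookup B i) i∈
  ... | inj₁ a = inj₁ (lookup⇒[]= i A a)
  ... | inj₂ b = inj₂ (lookup⇒[]= i B b)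

  union-cdist≥2 : ∀ {i j} → InUnion A B i → InUnion A B j → i ≢ j → 2 ≤ cdist i j
  union-cdist≥2 {i} {j} i∈ j∈ i≢j = ≤∧≢⇒< (cdist>0 i≢j) (cdist≢1 ∘ sym)
    where
    2+h≰1 : ¬ 2 + h ≤ 1
    2+h≰1 (s≤s ())
    cdist≢1 : cdist i j ≢ 1
    cdist≢1 d≡1 with ∈-union i∈ | ∈-union j∈
    ... | inj₁ i∈A | inj₁ j∈A = indA i j d≡1 (i∈A , j∈A)
    ... | inj₂ i∈B | inj₂ j∈B = indB i j d≡1 (i∈B , j∈B)
    ... | inj₁ i∈A | inj₂ j∈B = 2+h≰1 (subst (2 + h ≤_) d≡1 (far i j i∈A j∈B i≢j))
    ... | inj₂ i∈B | inj₁ j∈A =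
      2+h≰1 (subst (2 + h ≤_) (trans (cdist-comm j i) d≡1) (far j i j∈A i∈B (i≢j ∘ sym)))

  weight≤cdist : ∀ {i j} → InUnion A B i → InUnion A B j → i ≢ j →
                 weight h (labelAt A B i) (labelAt A B j) ≤ cdist i j
  weight≤cdist {i} {j} i∈ j∈ i≢j with mixed≡0⊎mixed≡1 (labelAt A B i) (labelAt A B j)
  ... | inj₁ m≡0 rewrite m≡0 | *-zeroʳ h = union-cdist≥2 i∈ j∈ i≢j
  ... | inj₂ m≡1 rewrite m≡1 | *-identityʳ h
    with mixed-label (lookup A i) (lookup B i) (lookup A j) (lookup B j) i∈ j∈ m≡1
  ...   | inj₁ (a , b′) = far i j (lookup⇒[]= i A a) (lookup⇒[]= j B b′) i≢j
  ...   | inj₂ (b , a′) =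
    subst (2 + h ≤_) (cdist-comm j i) (far j i (lookup⇒[]= j A a′) (lookup⇒[]= i B b) (i≢j ∘ sym))

  weights≤cycleLength : 2 ≤ length (labels A B) →
    2 * length (labels A B) + h * cyclicSum mixed (labels A B) ≤ s
  weights≤cycleLength k≥2 = begin
    2 * length (labels A B) + h * cyclicSum mixed (labels A B)
      ≡⟨ sym (cyclicSum-affine 2 h mixed (labels A B)) ⟩
    cyclicSum (weight h) (labels A B)
      ≡⟨ cyclicSum-map (weight h) (labelAt A B) (support A B) ⟩
    cyclicSum (λ i j → weight h (labelAt A B i) (labelAt A B j)) (support A B)
      ≤⟨ cyclicSum≤cycleLength _ weight≤cdist (support A B)
           (subst (2 ≤_) (length-map (labelAt A B) (support A B)) k≥2)
           (support-increasing A B) (support⊆union A B) ⟩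
    s ∎
    where open ≤-Reasoning

2*x≤s⇒x≤s/2 : ∀ x {s} → 2 * x ≤ s → x ≤ s / 2
2*x≤s⇒x≤s/2 x {s} 2x≤s = begin
  x         ≡⟨ sym (m*n/n≡m x 2) ⟩
  x * 2 / 2 ≤⟨ /-monoˡ-≤ 2 (subst (_≤ s) (*-comm 2 x) 2x≤s) ⟩
  s / 2     ∎
  where open ≤-Reasoning

module _ {s : ℕ} {A B : Subset s} (indA : Independent A) (indB : Independent B) (b>0 : 0 < ∣ B ∣) where

  private
    L = labels A B
    k = length L
    c = countBoth L
    m = cyclicSum mixed L
    a = ∣ A ∣
    b = ∣ B ∣

    a≤k : a ≤ k
    a≤k = subst (_≤ k) (countA-labels A B) (countA≤length L)

    m-lower-bounds : 0 < a → c < k → 2 ≤ m × suc c ≤ m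
    m-lower-bounds a>0 = mixed-lower-bounds L
      (subst (0 <_) (sym (countA-labels A B)) a>0) (subst (0 <_) (sym (countB-labels A B)) b>0)

  farApart⇒bound-disjoint : ∀ {h} → A ∩ B ≡ ⊥ → 0 < a → FarApart A B (2 + h) → 2 * (h + a + b) ≤ s
  farApart⇒bound-disjoint {h} disjoint a>0 far = begin
    2 * (h + a + b)     ≡⟨ regroup h a b ⟩
    2 * (a + b) + h * 2 ≡⟨ cong (λ n → 2 * n + h * 2) a+b≡k ⟩
    2 * k + h * 2       ≤⟨ +-monoʳ-≤ (2 * k) (*-monoʳ-≤ h (proj₁ (m-lower-bounds a>0 c<k))) ⟩
    2 * k + h * m       ≤⟨ weights≤cycleLength indA indB far (subst (2 ≤_) a+b≡k (+-mono-≤ a>0 b>0)) ⟩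
    s                   ∎
    where
    open ≤-Reasoning
    regroup : ∀ h a b → 2 * (h + a + b) ≡ 2 * (a + b) + h * 2
    regroup = solve-∀
    c≡0 : c ≡ 0
    c≡0 = trans (countBoth-labels A B) (trans (cong ∣_∣ disjoint) (∣⊥∣≡0 s))
    a+b≡k : a + b ≡ k
    a+b≡k = trans (∣A∣+∣B∣≡length+countBoth A B) (trans (cong (_+_ k) c≡0) (+-identityʳ k))
    c<k : c < k
    c<k = subst (_< k) (sym c≡0) (≤-trans a>0 (subst (a ≤_) a+b≡k (m≤m+n a b)))

  farApart⇒bound : ∀ {h} → 2 ≤ a → FarApart A B (4 + h) → (4 + h) * a ≤ s ⊎ 2 * suc (h + a + b) ≤ s
  farApart⇒bound {h} a≥2 far with c <? k
  ... | yes c<k = inj₂ (begin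
    2 * suc (h + a + b)         ≡⟨ cong (λ n → 2 * suc n) (+-assoc h a b) ⟩
    2 * suc (h + (a + b))       ≡⟨ cong (λ n → 2 * suc (h + n)) (∣A∣+∣B∣≡length+countBoth A B) ⟩
    2 * suc (h + (k + c))       ≡⟨ regroup h k c ⟩
    2 * k + (2 * suc c + h * 2) ≤⟨ +-monoʳ-≤ (2 * k) (+-mono-≤ (*-monoʳ-≤ 2 m>c) (*-monoʳ-≤ h m≥2)) ⟩
    2 * k + (2 * m + h * m)     ≡⟨ cong (_+_ (2 * k)) (sym (*-distribʳ-+ m 2 h)) ⟩
    2 * k + (2 + h) * m         ≤⟨ weights≤cycleLength indA indB far (≤-trans a≥2 a≤k) ⟩
    s                           ∎)
    where
    open ≤-Reasoning
    regroup : ∀ h k c → 2 * suc (h + (k + c)) ≡ 2 * k + (2 * suc c + h * 2)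
    regroup = solve-∀
    m≥2 = proj₁ (m-lower-bounds (≤-trans (s≤s z≤n) a≥2) c<k)
    m>c = proj₂ (m-lower-bounds (≤-trans (s≤s z≤n) a≥2) c<k)
  ... | no c≮k = inj₁ (begin
    (4 + h) * a         ≡⟨ *-distribʳ-+ a 2 (2 + h) ⟩
    2 * a + (2 + h) * a ≤⟨ +-mono-≤ (*-monoʳ-≤ 2 a≤k) (*-monoʳ-≤ (2 + h) a≤m) ⟩
    2 * k + (2 + h) * m ≤⟨ weights≤cycleLength indA indB far (≤-trans a≥2 a≤k) ⟩
    s                   ∎)
    where
    open ≤-Reasoning
    a≤m : a ≤ m
    a≤m = ≤-trans a≤k (≤-trans (≮⇒≥ c≮k) (countBoth≤mixed L))

PairWithin : {s : ℕ} → Subset s → Subset s → (ℕ → Set) → Set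
PairWithin A B Bound = ∃[ v₁ ] ∃[ v₂ ] (v₁ ∈ A × v₂ ∈ B × 0 < cdist v₁ v₂ × Bound (cdist v₁ v₂))

pairWithin-map : {s : ℕ} {A B : Subset s} {P Q : ℕ → Set} →
                 (∀ d → P d → Q d) → PairWithin A B P → PairWithin A B Q
pairWithin-map P⇒Q (v₁ , v₂ , v₁∈A , v₂∈B , d>0 , Pd) =
  v₁ , v₂ , v₁∈A , v₂∈B , d>0 , P⇒Q _ Pd

-- FarApart A B g with g > s says that A and B contain no two distinct points at all.
closestPair-within : {s : ℕ} {A B : Subset s} {P : ℕ → Set} {g : ℕ} →
                     (∀ d → FarApart A B d → P d) → ¬ FarApart A B g → PairWithin A B P
closestPair-within {A = A} {B} {g = g} bound not-far with farApart⊎closestPair A B g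
... | inj₁ far = contradiction far not-far
... | inj₂ (v₁ , v₂ , v₁∈A , v₂∈B , v₁≢v₂ , far) =
  v₁ , v₂ , v₁∈A , v₂∈B , cdist>0 v₁≢v₂ , bound (cdist v₁ v₂) far

module _ {s : ℕ} {A B : Subset s} (indA : Independent A) (indB : Independent B) (b>0 : 0 < ∣ B ∣) where

  pairWithin-disjoint : A ∩ B ≡ ⊥ → 0 < ∣ A ∣ →
    PairWithin A B (λ d → d ≤ 1 ⊎ d + ∣ A ∣ + ∣ B ∣ ≤ s / 2 + 2)
  pairWithin-disjoint disjoint a>0 = closestPair-within bound not-far
    where
    bound : ∀ d → FarApart A B d → d ≤ 1 ⊎ d + ∣ A ∣ + ∣ B ∣ ≤ s / 2 + 2
    bound 0             _   = inj₁ z≤n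
    bound 1             _   = inj₁ ≤-refl
    bound (suc (suc h)) far = inj₂ (subst (_≤ s / 2 + 2) (+-comm (h + ∣ A ∣ + ∣ B ∣) 2)
      (+-monoˡ-≤ 2 (2*x≤s⇒x≤s/2 (h + ∣ A ∣ + ∣ B ∣)
        (farApart⇒bound-disjoint indA indB b>0 disjoint a>0 far))))
    not-far : ¬ FarApart A B (2 + s)
    not-far far = <⇒≱ (<-≤-trans (<-≤-trans (m<m+n s a>0) (m≤m+n _ _)) (m≤n*m _ 2))
      (farApart⇒bound-disjoint indA indB b>0 disjoint a>0 far)

  pairWithin : 2 ≤ ∣ A ∣ →
    PairWithin A B (λ d → d ≤ 3 ⊎ d * ∣ A ∣ ≤ s ⊎ d + ∣ A ∣ + ∣ B ∣ ≤ s / 2 + 3)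
  pairWithin a≥2 = closestPair-within bound not-far
    where
    bound : ∀ d → FarApart A B d → d ≤ 3 ⊎ d * ∣ A ∣ ≤ s ⊎ d + ∣ A ∣ + ∣ B ∣ ≤ s / 2 + 3
    bound 0 _ = inj₁ z≤n
    bound 1 _ = inj₁ (s≤s z≤n)
    bound 2 _ = inj₁ (s≤s (s≤s z≤n))
    bound 3 _ = inj₁ ≤-refl
    bound (suc (suc (suc (suc h)))) far with farApart⇒bound indA indB b>0 a≥2 far
    ... | inj₁ d*a≤s        = inj₂ (inj₁ d*a≤s)
    ... | inj₂ 2[1+h+a+b]≤s = inj₂ (inj₂ (subst (_≤ s / 2 + 3) (+-comm (suc (h + ∣ A ∣ + ∣ B ∣)) 3)
      (+-monoˡ-≤ 3 (2*x≤s⇒x≤s/2 (suc (h + ∣ A ∣ + ∣ B ∣)) 2[1+h+a+b]≤s))))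
    not-far : ¬ FarApart A B (4 + s)
    not-far far with farApart⇒bound indA indB b>0 a≥2 far
    ... | inj₁ le =
      <⇒≱ (<-≤-trans (m<n+m s z<s) (m≤m*n (4 + s) ∣ A ∣ {{ℕ.>-nonZero (<-≤-trans z<s a≥2)}})) le
    ... | inj₂ le = <⇒≱ (<-≤-trans (s≤s (≤-trans (m≤m+n s _) (m≤m+n _ _))) (m≤n*m _ 2)) le

-- Transfer of the bounds to ℤ and ℚ

i+j≤k⇒i≤k-j : ∀ {i j k} → i Z.+ j Z.≤ k → i Z.≤ k - j
i+j≤k⇒i≤k-j {i} {j} {k} i+j≤k = begin
  i           ≡⟨ sym (//-rightDividesʳ j i) ⟩
  i Z.+ j - j ≤⟨ ZP.+-monoˡ-≤ (Z.- j) i+j≤k ⟩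
  k - j       ∎
  where
  open ZP.≤-Reasoning
  open GroupProperties (AbelianGroup.group ZP.+-0-abelianGroup) using (//-rightDividesʳ)

p+q≤r⇒p≤r-q : ∀ {p q r} → p Q.+ q Q.≤ r → p Q.≤ r Q.- q
p+q≤r⇒p≤r-q {p} {q} {r} p+q≤r = begin
  p             ≡⟨ sym (//-rightDividesʳ q p) ⟩
  p Q.+ q Q.- q ≤⟨ QP.+-monoˡ-≤ (Q.- q) p+q≤r ⟩
  r Q.- q       ∎
  where
  open QP.≤-Reasoning
  open GroupProperties QP.+-0-group using (//-rightDividesʳ)

ℕ→ℚ-+ : ∀ m n → ℕ→ℚ (m + n) ≡ ℕ→ℚ m Q.+ ℕ→ℚ n
ℕ→ℚ-+ m n = begin
  (+ (m + n)) Q./ 1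
    ≡⟨ cong (Q._/ 1) (sym (cong₂ Z._+_ (ZP.*-identityʳ (+ m)) (ZP.*-identityʳ (+ n)))) ⟩
  (+ m Z.* + 1 Z.+ + n Z.* + 1) Q./ 1
    ≡⟨ cong₂ Q._+_ (sym (normal-form m)) (sym (normal-form n)) ⟩
  ℕ→ℚ m Q.+ ℕ→ℚ n
    ∎
  where
  open ≡-Reasoning
  normal-form : ∀ m → ℕ→ℚ m ≡ Q.mkℚ (+ m) 0 (Coprimality.sym (1-coprimeTo m))
  normal-form m = QP.normalize-coprime (Coprimality.sym (1-coprimeTo m))

fromℚᵘ-mono-≤ : ∀ {p q} → p U.≤ q → Q.fromℚᵘ p Q.≤ Q.fromℚᵘ q
fromℚᵘ-mono-≤ {p} {q} p≤q = QP.toℚᵘ-cancel-≤ (UP.≤-respʳ-≃ (UP.≃-sym (QP.toℚᵘ-fromℚᵘ q))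
  (UP.≤-respˡ-≃ (UP.≃-sym (QP.toℚᵘ-fromℚᵘ p)) p≤q))

ℕ→ℚ-mono-≤ : ∀ {m n} → m ≤ n → ℕ→ℚ m Q.≤ ℕ→ℚ n
ℕ→ℚ-mono-≤ {m} {n} m≤n = fromℚᵘ-mono-≤ {mkℚᵘ (+ m) 0} {mkℚᵘ (+ n) 0}
  (*≤* (subst₂ Z._≤_ (sym (ZP.*-identityʳ _)) (sym (ZP.*-identityʳ _)) (Z.+≤+ m≤n)))

ℕ→ℚ-≤-/ℕ : ∀ {d k s} → d * suc k ≤ s → ℕ→ℚ d Q.≤ s /ℕ suc k
ℕ→ℚ-≤-/ℕ {d} {k} {s} d*k≤s = fromℚᵘ-mono-≤ {mkℚᵘ (+ d) 0} {mkℚᵘ (+ s) k}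
  (*≤* (subst₂ Z._≤_ (ZP.pos-* d (suc k)) (sym (ZP.*-identityʳ (+ s))) (Z.+≤+ d*k≤s)))

sum-bound⇒ℤ : ∀ d a b {X} → d + a + b ≤ X → + d Z.≤ + X - + a - + b
sum-bound⇒ℤ d a b {X} d+a+b≤X = i+j≤k⇒i≤k-j {j = + b}
  (i+j≤k⇒i≤k-j {j = + a} (Z.+≤+ (subst (_≤ X) (xy∙z≈xz∙y d a b) d+a+b≤X)))

sum-bound⇒ℚ : ∀ d a b {X} → d + a + b ≤ X → ℕ→ℚ d Q.≤ ℕ→ℚ X Q.- ℕ→ℚ a Q.- ℕ→ℚ b
sum-bound⇒ℚ d a b {X} d+a+b≤X = p+q≤r⇒p≤r-q (p+q≤r⇒p≤r-q (subst (Q._≤ ℕ→ℚ X)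
  (trans (ℕ→ℚ-+ (d + b) a) (cong (Q._+ ℕ→ℚ a) (ℕ→ℚ-+ d b)))
  (ℕ→ℚ-mono-≤ (subst (_≤ X) (xy∙z≈xz∙y d a b) d+a+b≤X))))

bound⇒ℤ : ∀ {a b X} d → d ≤ 1 ⊎ d + a + b ≤ X → + d Z.≤ (+ 1) Z.⊔ (+ X - + a - + b)
bound⇒ℤ         _ (inj₁ d≤1)      = ZP.≤-trans (Z.+≤+ d≤1) (ZP.i≤i⊔j _ _)
bound⇒ℤ {a} {b} d (inj₂ d+a+b≤X) = ZP.≤-trans (sum-bound⇒ℤ d a b d+a+b≤X) (ZP.i≤j⊔i _ _)

bound⇒ℚ : ∀ {a b s X} → 0 < a → ∀ d → d ≤ 3 ⊎ d * a ≤ s ⊎ d + a + b ≤ X →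
  ℕ→ℚ d Q.≤ ((ℕ→ℚ 3 Q.⊔ (s /ℕ a)) Q.⊔ ((ℕ→ℚ X Q.- ℕ→ℚ a) Q.- ℕ→ℚ b))
bound⇒ℚ {a@(suc _)} {b} {s} {X} _ d = λ where
    (inj₁ d≤3) → QP.≤-trans (ℕ→ℚ-mono-≤ {d} d≤3)
      (QP.≤-trans (QP.p≤p⊔q three ratio) (QP.p≤p⊔q _ excess))
    (inj₂ (inj₁ d*a≤s)) → QP.≤-trans (ℕ→ℚ-≤-/ℕ {d} d*a≤s)
      (QP.≤-trans (QP.p≤q⊔p three ratio) (QP.p≤p⊔q _ excess))
    (inj₂ (inj₂ d+a+b≤X)) → QP.≤-trans (sum-bound⇒ℚ d a b d+a+b≤X)
      (QP.p≤q⊔p (three Q.⊔ ratio) excess)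
  where
  three = ℕ→ℚ 3
  ratio = s /ℕ a
  excess = (ℕ→ℚ X Q.- ℕ→ℚ a) Q.- ℕ→ℚ b

mainTheorem11 : ∀ {n s : ℕ} (G : Graph n) (C : Cycle G s) → 3 ≤ s →
    (u₁ u₂ : Fin n) → ¬ OnCycle C u₁ → ¬ OnCycle C u₂ → u₁ ≢ u₂ →
    1 ≤ degC C u₁ → 1 ≤ degC C u₂ →
    NoConsecutive C u₁ → NoConsecutive C u₂ →
    ((NC C u₁ ∩ NC C u₂ ≡ ⊥ →
        ∃[ v₁ ] ∃[ v₂ ] (v₁ ∈ NC C u₁ × v₂ ∈ NC C u₂ × 1 ≤ cdist v₁ v₂ ×
          (+ cdist v₁ v₂) Z.≤ ((+ 1) Z.⊔ (+ (s / 2 + 2) - + degC C u₁ - + degC C u₂))))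
    × (2 ≤ degC C u₁ →
        ∃[ v₁ ] ∃[ v₂ ] (v₁ ∈ NC C u₁ × v₂ ∈ NC C u₂ × 1 ≤ cdist v₁ v₂ ×
          ℕ→ℚ (cdist v₁ v₂) Q.≤ ((ℕ→ℚ 3 Q.⊔ (s /ℕ degC C u₁))
            Q.⊔ ((ℕ→ℚ (s / 2 + 3) Q.- ℕ→ℚ (degC C u₁)) Q.- ℕ→ℚ (degC C u₂))))))
mainTheorem11 _ _ _ _ _ _ _ _ deg₁>0 deg₂>0 indep₁ indep₂ =
  (λ disjoint → pairWithin-map bound⇒ℤ (pairWithin-disjoint indep₁ indep₂ deg₂>0 disjoint deg₁>0)) ,
  (λ deg₁≥2 → pairWithin-map (bound⇒ℚ deg₁>0) (pairWithin indep₁ indep₂ deg₂>0 deg₁≥2))
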